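{- Let $\Sigma$ be a single-sorted signature (of arbitrary size, not necessarily discrete, possibly containing function symbols), let $\mathbb{T}$ be a regular theory over $\Sigma$, and let $\mathcal{M}$ be a full subcategory of $\mathrm{Mod}(\mathbb{T})$ which is strongly conservative. Then the evaluation functor $\mathrm{Ev}:\mathcal{C}_{\mathbb{T}}\to\mathbf{Set}^{\mathcal{M}}$ (a) is conservative, and (b) whenever the pullback functor $f^*:\mathrm{Sub}_{\mathcal{C}_{\mathbb{T}}}(B)\to\mathrm{Sub}_{\mathcal{C}_{\mathbb{T}}}(A)$ induced by a morphism $f:A\to B$ of $\mathcal{C}_{\mathbb{T}}$ has a right adjoint $\forall_f$, we have $\mathrm{Ev}(\forall_f(S))=\forall_{\mathrm{Ev}(f)}(\mathrm{Ev}(S))$ for all $S\in\mathrm{Sub}_{\mathcal{C}_{\mathbb{T}}}(A)$.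
   Context: The metatheory is IZF. Sequents $\phi\vdash_{\mathbf{x}}\psi$ express $\forall\mathbf{x}(\phi\to\psi)$; deduction is intuitionistic free logic (domains may be empty). Regular formulas use $\top,\wedge,\exists$; a regular theory is a set of regular sequents. $\mathrm{Mod}(\mathbb{T})$ is the category of Tarski models of $\mathbb{T}$ (equality interpreted as identity) and homomorphisms. $\mathcal{C}_{\mathbb{T}}$ is the regular syntactic category of $\mathbb{T}$: objects are regular formulas-in-context $\{\mathbf{x}.\phi\}$ up to $\alpha$-equivalence, morphisms are $\mathbb{T}$-provably functional regular relations. $\mathrm{Ev}$ sends $\{\mathbf{x}.\phi\}$ to the functor $\mathbf{M}\mapsto[\![\mathbf{x}.\phi]\!]^{\mathbf{M}}$ (extension of $\phi$ in $\mathbf{M}$), and acts on morphisms accordingly. For a model $\mathbf{M}$, $\mathbb{T}_{\mathbf{M}}$ is the theory of $\mathbf{M}$ ($\mathbb{T}$ with the elements of $\mathbf M$ as constants and the atomic facts of $\mathbf M$ as axioms), so that $\mathbb{T}_{\mathbf M}$-models correspond to homomorphisms out of $\mathbf M$. $\mathcal{M}$ is conservative if every regular sequent over $\Sigma$ true in all members of $\mathcal{M}$ is provable in $\mathbb{T}$; strongly conservative if moreover for each $\mathbf{M}\in\mathcal{M}$, every regular sequent over the signature of $\mathbb{T}_{\mathbf M}$ true in all $\mathbb{T}_{\mathbf{M}}$-models corresponding to homomorphisms $\mathbf{M}\to\mathbf{N}$ in $\mathcal{M}$ is provable in $\mathbb{T}_{\mathbf{M}}$. -}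

module Defs where

open import Data.Nat using (ℕ; zero; suc; _+_)
open import Data.Fin using (Fin; zero; suc; _↑ˡ_; _↑ʳ_; splitAt)
open import Data.Vec using (Vec; []; _∷_)
import Data.Vec as V
open import Data.Sum using (_⊎_; inj₁; inj₂; [_,_]′)
open import Data.Product using (Σ; _×_; _,_; proj₁; proj₂)
open import Data.Unit using (⊤; tt)
open import Relation.Binary.PropositionalEquality using (_≡_; refl; cong; cong₂; trans; sym; subst)
open import Function using (_∘_; id)

record Signature : Set₁ where
  field
    Fun   : Set
    funAr : Fun → ℕ
    Rel   : Set
    relAr : Rel → ℕ
open Signature public

_∷ₑ_ : ∀ {n} {X : Set} → X → (Fin n → X) → Fin (suc n) → X
(a ∷ₑ e) zero    = a
(a ∷ₑ e) (suc i) = e i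

⟨_,_⟩ : ∀ {a b} {X : Set} → (Fin a → X) → (Fin b → X) → Fin (a + b) → X
⟨_,_⟩ {a} f g i = [ f , g ]′ (splitAt a i)

-- Syntax: terms and regular formulas in a context of n variables
-- (de Bruijn indices, so alpha-equivalent formulas are identical).

module _ (Sg : Signature) where
  data Term (n : ℕ) : Set where
    var : Fin n → Term n
    app : (f : Fun Sg) → Vec (Term n) (funAr Sg f) → Term n

  data Fm (n : ℕ) : Set where
    ⊤ᶠ   : Fm n
    _∧ᶠ_ : Fm n → Fm n → Fm n
    ∃ᶠ   : Fm (suc n) → Fm n      -- binds variable zero
    _≐_  : Term n → Term n → Fm n
    rel  : (R : Rel Sg) → Vec (Term n) (relAr Sg R) → Fm n

  record Sequent : Set where
    constructor seq
    field
      ctx : ℕ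
      ant : Fm ctx
      con : Fm ctx

  Theory : Set₁
  Theory = Sequent → Set

  record Obj : Set where
    constructor ob
    field
      ar : ℕ
      fm : Fm ar

  record Structure : Set₁ where
    field
      Carrier : Set
      funI    : (f : Fun Sg) → Vec Carrier (funAr Sg f) → Carrier
      relI    : (R : Rel Sg) → Vec Carrier (relAr Sg R) → Set

open Sequent public
open Obj public
open Structure public

module _ {Sg : Signature} where

  mutual
    sub : ∀ {n m} → (Fin n → Term Sg m) → Term Sg n → Term Sg m
    sub σ (var i)    = σ i
    sub σ (app f ts) = app f (subs σ ts)

    subs : ∀ {n m k} → (Fin n → Term Sg m) → Vec (Term Sg n) k → Vec (Term Sg m) k
    subs σ []       = []
    subs σ (t ∷ ts) = sub σ t ∷ subs σ ts

  ren : ∀ {n m} → (Fin n → Fin m) → Term Sg n → Term Sg m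
  ren ρ = sub (var ∘ ρ)

  lift : ∀ {n m} → (Fin n → Term Sg m) → Fin (suc n) → Term Sg (suc m)
  lift σ zero    = var zero
  lift σ (suc i) = ren suc (σ i)

  subF : ∀ {n m} → (Fin n → Term Sg m) → Fm Sg n → Fm Sg m
  subF σ ⊤ᶠ         = ⊤ᶠ
  subF σ (φ ∧ᶠ ψ)   = subF σ φ ∧ᶠ subF σ ψ
  subF σ (∃ᶠ φ)     = ∃ᶠ (subF (lift σ) φ)
  subF σ (s ≐ t)    = sub σ s ≐ sub σ t
  subF σ (rel R ts) = rel R (subs σ ts)

  renF : ∀ {n m} → (Fin n → Fin m) → Fm Sg n → Fm Sg m
  renF ρ = subF (var ∘ ρ)

  single : ∀ {n} → Term Sg n → Fin (suc n) → Term Sg n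
  single t zero    = t
  single t (suc i) = var i

  ⋀ : ∀ {k n} → (Fin k → Fm Sg n) → Fm Sg n
  ⋀ {zero}  φs = ⊤ᶠ
  ⋀ {suc k} φs = φs zero ∧ᶠ ⋀ (φs ∘ suc)

  ∃* : ∀ m {n} → Fm Sg (m + n) → Fm Sg n
  ∃* zero    φ = φ
  ∃* (suc m) φ = ∃* m (∃ᶠ φ)

  data Atomic {n} : Fm Sg n → Set where
    eqA  : ∀ s t → Atomic (s ≐ t)
    relA : ∀ R ts → Atomic (rel R ts)

  -- Deduction: regular fragment of intuitionistic logic in contexts
  -- (Johnstone, Elephant D1.3), so domains may be empty.

  data Pf (T : Theory Sg) : (n : ℕ) → Fm Sg n → Fm Sg n → Set where
    ax     : ∀ {n φ ψ} → T (seq n φ ψ) → Pf T n φ ψ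
    idR    : ∀ {n φ} → Pf T n φ φ
    cut    : ∀ {n φ ψ χ} → Pf T n φ ψ → Pf T n ψ χ → Pf T n φ χ
    substR : ∀ {n m φ ψ} (σ : Fin n → Term Sg m) → Pf T n φ ψ → Pf T m (subF σ φ) (subF σ ψ)
    eqRefl : ∀ {n} (t : Term Sg n) → Pf T n ⊤ᶠ (t ≐ t)
    eqSub  : ∀ {n} (φ : Fm Sg (suc n)) (s t : Term Sg n) →
             Pf T n ((s ≐ t) ∧ᶠ subF (single s) φ) (subF (single t) φ)
    ⊤I     : ∀ {n φ} → Pf T n φ ⊤ᶠ
    ∧E₁    : ∀ {n φ ψ} → Pf T n (φ ∧ᶠ ψ) φ
    ∧E₂    : ∀ {n φ ψ} → Pf T n (φ ∧ᶠ ψ) ψ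
    ∧I     : ∀ {n φ ψ χ} → Pf T n φ ψ → Pf T n φ χ → Pf T n φ (ψ ∧ᶠ χ)
    ∃E     : ∀ {n φ ψ} → Pf T (suc n) φ (renF suc ψ) → Pf T n (∃ᶠ φ) ψ
    ∃E⁻¹   : ∀ {n φ ψ} → Pf T n (∃ᶠ φ) ψ → Pf T (suc n) φ (renF suc ψ)
    frob   : ∀ {n φ ψ} → Pf T n (φ ∧ᶠ ∃ᶠ ψ) (∃ᶠ (renF suc φ ∧ᶠ ψ))

  Provable : Theory Sg → Sequent Sg → Set
  Provable T s = Pf T (ctx s) (ant s) (con s)


  module _ (M : Structure Sg) where
    mutual
      evalT : ∀ {n} → (Fin n → Carrier M) → Term Sg n → Carrier M
      evalT e (var i)    = e i
      evalT e (app f ts) = funI M f (evalTs e ts)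

      evalTs : ∀ {n k} → (Fin n → Carrier M) → Vec (Term Sg n) k → Vec (Carrier M) k
      evalTs e []       = []
      evalTs e (t ∷ ts) = evalT e t ∷ evalTs e ts

    ⟦_⟧ : ∀ {n} → Fm Sg n → (Fin n → Carrier M) → Set
    ⟦ ⊤ᶠ ⟧ e       = ⊤
    ⟦ φ ∧ᶠ ψ ⟧ e   = ⟦ φ ⟧ e × ⟦ ψ ⟧ e
    ⟦ ∃ᶠ φ ⟧ e     = Σ (Carrier M) λ a → ⟦ φ ⟧ (a ∷ₑ e)
    ⟦ s ≐ t ⟧ e    = evalT e s ≡ evalT e t
    ⟦ rel R ts ⟧ e = relI M R (evalTs e ts)

  _⊨_ : Structure Sg → Sequent Sg → Set
  M ⊨ s = ∀ e → ⟦ M ⟧ (ant s) e → ⟦ M ⟧ (con s) e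

  record Model (T : Theory Sg) : Set₁ where
    field
      str   : Structure Sg
      sound : ∀ s → T s → str ⊨ s

  record Hom (M N : Structure Sg) : Set where
    field
      hmap    : Carrier M → Carrier N
      presFun : ∀ f as → hmap (funI M f as) ≡ funI N f (V.map hmap as)
      presRel : ∀ R as → relI M R as → relI N R (V.map hmap as)

open Model public
open Hom public

module _ {Sg : Signature} {M N : Structure Sg} (h : Hom M N) where
  mutual
    presT : ∀ {n} (e : Fin n → Carrier M) (e' : Fin n → Carrier N) →
            (∀ i → hmap h (e i) ≡ e' i) → (t : Term Sg n) →
            hmap h (evalT M e t) ≡ evalT N e' t
    presT e e' eq (var i)    = eq i
    presT e e' eq (app f ts) =
      trans (presFun h f (evalTs M e ts)) (cong (funI N f) (presTs e e' eq ts))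

    presTs : ∀ {n k} (e : Fin n → Carrier M) (e' : Fin n → Carrier N) →
             (∀ i → hmap h (e i) ≡ e' i) → (ts : Vec (Term Sg n) k) →
             V.map (hmap h) (evalTs M e ts) ≡ evalTs N e' ts
    presTs e e' eq []       = refl
    presTs e e' eq (t ∷ ts) = cong₂ _∷_ (presT e e' eq t) (presTs e e' eq ts)

  presF : ∀ {n} (φ : Fm Sg n) (e : Fin n → Carrier M) (e' : Fin n → Carrier N) →
          (∀ i → hmap h (e i) ≡ e' i) → ⟦ M ⟧ φ e → ⟦ N ⟧ φ e'
  presF ⊤ᶠ e e' eq p = tt
  presF (φ ∧ᶠ ψ) e e' eq (p , q) = presF φ e e' eq p , presF ψ e e' eq q
  presF {n} (∃ᶠ φ) e e' eq (a , p) = hmap h a , presF φ (_∷ₑ_ {n} a e) (_∷ₑ_ {n} (hmap h a) e') eq' p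
    where
      eq' : ∀ i → hmap h (_∷ₑ_ {n} a e i) ≡ _∷ₑ_ {n} (hmap h a) e' i
      eq' zero    = refl
      eq' (suc i) = eq i
  presF (s ≐ t) e e' eq p = trans (sym (presT e e' eq s)) (trans (cong (hmap h) p) (presT e e' eq t))
  presF (rel R ts) e e' eq p = subst (relI N R) (presTs e e' eq ts) (presRel h R (evalTs M e ts) p)

  -- the action of Ev({x.φ}) on h : M → N
  EvHom : ∀ {n} (φ : Fm Sg n) (b : Fin n → Carrier M) → ⟦ M ⟧ φ b → ⟦ N ⟧ φ (hmap h ∘ b)
  EvHom φ b = presF φ b (hmap h ∘ b) (λ _ → refl)

-- The theory T_M of a model M: signature extended by a constant for each
-- element of M; axioms: those of T plus all atomic sentences true in M.

SigC : Signature → Set → Signature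
SigC Sg A = record
  { Fun = Fun Sg ⊎ A ; funAr = [ funAr Sg , (λ _ → 0) ]′
  ; Rel = Rel Sg ; relAr = relAr Sg }

module _ {Sg : Signature} {A : Set} where
  mutual
    trT : ∀ {n} → Term Sg n → Term (SigC Sg A) n
    trT (var i)    = var i
    trT (app f ts) = app (inj₁ f) (trTs ts)

    trTs : ∀ {n k} → Vec (Term Sg n) k → Vec (Term (SigC Sg A) n) k
    trTs []       = []
    trTs (t ∷ ts) = trT t ∷ trTs ts

  trF : ∀ {n} → Fm Sg n → Fm (SigC Sg A) n
  trF ⊤ᶠ         = ⊤ᶠ
  trF (φ ∧ᶠ ψ)   = trF φ ∧ᶠ trF ψ
  trF (∃ᶠ φ)     = ∃ᶠ (trF φ)
  trF (s ≐ t)    = trT s ≐ trT t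
  trF (rel R ts) = rel R (trTs ts)

  trSeq : Sequent Sg → Sequent (SigC Sg A)
  trSeq s = seq (ctx s) (trF (ant s)) (trF (con s))

  expand : (N : Structure Sg) → (A → Carrier N) → Structure (SigC Sg A)
  expand N c = record
    { Carrier = Carrier N
    ; funI = λ { (inj₁ f) as → funI N f as ; (inj₂ a) _ → c a }
    ; relI = relI N }

module _ {Sg : Signature} {T : Theory Sg} where

  data ThM (M : Model T) : Theory (SigC Sg (Carrier (str M))) where
    base : ∀ {s} → T s → ThM M (trSeq s)
    diag : (α : Fm (SigC Sg (Carrier (str M))) 0) → Atomic α →
           ⟦ expand (str M) id ⟧ α (λ ()) → ThM M (seq 0 ⊤ᶠ α)

  -- 𝓜 : a full subcategory of Mod(T), given by its class of objects
  Conservative : (Model T → Set) → Set₁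
  Conservative 𝓜 = ∀ (s : Sequent Sg) → (∀ N → 𝓜 N → str N ⊨ s) → Provable T s

  -- the T_M-model corresponding to h : M → N is N with constants c_a ↦ h a
  StronglyConservative : (Model T → Set) → Set₁
  StronglyConservative 𝓜 =
    Conservative 𝓜 ×
    (∀ M → 𝓜 M → ∀ (s : Sequent (SigC Sg (Carrier (str M)))) →
       (∀ N → 𝓜 N → (h : Hom (str M) (str N)) → expand (str N) (hmap h) ⊨ s) →
       Provable (ThM M) s)

  -- A morphism {x.φ} → {y.ψ} (|x| = n, |y| = m) is a formula θ in the
  -- context y,x (first the m target variables, then the n source ones)
  -- which is T-provably functional.

  record Mor (A B : Obj Sg) : Set where
    field
      θ     : Fm Sg (ar B + ar A)
      typed : Pf T (ar B + ar A) θ (renF (ar B ↑ʳ_) (fm A) ∧ᶠ renF (_↑ˡ ar A) (fm B))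
      total : Pf T (ar A) (fm A) (∃* (ar B) θ)
      funct : Pf T (ar B + (ar B + ar A))
                (renF (ar B ↑ʳ_) θ ∧ᶠ
                 renF ⟨ (λ i → i ↑ˡ (ar B + ar A)) , (λ l → ar B ↑ʳ (ar B ↑ʳ l)) ⟩ θ)
                (⋀ (λ i → var (ar B ↑ʳ (i ↑ˡ ar A)) ≐ var (i ↑ˡ (ar B + ar A))))
  open Mor public

  -- composite relation  ∃y (θ(x,y) ∧ η(y,z))  of θ : x ↦ y, η : y ↦ z
  compF : ∀ {n m k} → Fm Sg (m + n) → Fm Sg (k + m) → Fm Sg (k + n)
  compF {n} {m} {k} θ' η =
    ∃* m (renF ⟨ (λ i → i ↑ˡ (k + n)) , (λ l → m ↑ʳ (k ↑ʳ l)) ⟩ θ' ∧ᶠ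
          renF ⟨ (λ j → m ↑ʳ (j ↑ˡ n)) , (λ i → i ↑ˡ (k + n)) ⟩ η)

  -- identity relation  φ(x) ∧ x' = x
  idF : ∀ {n} → Fm Sg n → Fm Sg (n + n)
  idF {n} φ = renF (n ↑ʳ_) φ ∧ᶠ ⋀ (λ i → var (i ↑ˡ n) ≐ var (n ↑ʳ i))

  -- equality of morphisms of C_T: T-provable equivalence of the relations
  ProvEquiv : ∀ {n} → Fm Sg n → Fm Sg n → Set
  ProvEquiv {n} α β = Pf T n α β × Pf T n β α

  IsIsoC : ∀ {A B} → Mor A B → Set
  IsIsoC {A} {B} f = Σ (Mor B A) λ g →
    ProvEquiv (compF {ar A} {ar B} {ar A} (θ f) (θ g)) (idF (fm A)) ×
    ProvEquiv (compF {ar B} {ar A} {ar B} (θ g) (θ f)) (idF (fm B))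

  -- Ev({x.φ})(M) = [[x.φ]]^M, Ev({x.φ})(h) = h ∘ -,
  -- and Ev(f)_M is the function whose graph is [[θ]]^M.
  -- Ev(f) is an isomorphism in Set^𝓜: it has an inverse natural
  -- transformation (tuples compared pointwise).

  record EvIso (𝓜 : Model T → Set) {A B : Obj Sg} (f : Mor A B) : Set₁ where
    field
      inv      : (M : Model T) → 𝓜 M → (b : Fin (ar B) → Carrier (str M)) →
                 ⟦ str M ⟧ (fm B) b → Fin (ar A) → Carrier (str M)
      invDom   : ∀ M mM b p → ⟦ str M ⟧ (fm A) (inv M mM b p)
      invRight : ∀ M mM b p → ⟦ str M ⟧ (θ f) ⟨ b , inv M mM b p ⟩
      invLeft  : ∀ M mM a b → ⟦ str M ⟧ (fm A) a → ⟦ str M ⟧ (θ f) ⟨ b , a ⟩ →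
                 (p : ⟦ str M ⟧ (fm B) b) → ∀ i → inv M mM b p i ≡ a i
      natural  : ∀ M mM N mN (h : Hom (str M) (str N)) b p i →
                 inv N mN (hmap h ∘ b) (EvHom h (fm B) b p) i ≡ hmap h (inv M mM b p i)

  EvConservative : (Model T → Set) → Set₁
  EvConservative 𝓜 = ∀ (A B : Obj Sg) (f : Mor A B) → EvIso 𝓜 f → IsIsoC f

  -- Subobjects of A = {x.φ} in C_T: formulas χ in context x with χ ⊢ φ,
  -- ordered by T-provable entailment.
  -- Pullback f* : Sub(B) → Sub(A),  f*(χ) = ∃y (θ(x,y) ∧ χ(y)).
  pull : ∀ {A B} → Mor A B → Fm Sg (ar B) → Fm Sg (ar A)
  pull {A} {B} f χ = ∃* (ar B) (θ f ∧ᶠ renF (_↑ˡ ar A) χ)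

  -- R is (the action on representatives of) a right adjoint ∀_f of f*
  RightAdjoint : ∀ {A B} → Mor A B → (Fm Sg (ar A) → Fm Sg (ar B)) → Set
  RightAdjoint {A} {B} f R =
    (∀ S → Pf T (ar A) S (fm A) → Pf T (ar B) (R S) (fm B)) ×
    (∀ S χ → Pf T (ar A) S (fm A) → Pf T (ar B) χ (fm B) →
       (Pf T (ar A) (pull f χ) S → Pf T (ar B) χ (R S)) ×
       (Pf T (ar B) χ (R S) → Pf T (ar A) (pull f χ) S))

  -- ∀_{Ev f}(Ev S) in the presheaf category Set^𝓜, at M, evaluated at
  -- b ∈ Ev(B)(M): for all h : M → N in 𝓜 and a ∈ Ev(A)(N) with
  -- Ev(f)_N(a) = Ev(B)(h)(b), we have a ∈ Ev(S)(N).
  ForallEv : (Model T → Set) → ∀ {A B} → Mor A B → Fm Sg (ar A) →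
             (M : Model T) → (Fin (ar B) → Carrier (str M)) → Set₁
  ForallEv 𝓜 {A} {B} f S M b =
    ∀ N → 𝓜 N → (h : Hom (str M) (str N)) → (a : Fin (ar A) → Carrier (str N)) →
    ⟦ str N ⟧ (fm A) a → ⟦ str N ⟧ (θ f) ⟨ hmap h ∘ b , a ⟩ → ⟦ str N ⟧ S a

  EvPreservesForall : (Model T → Set) → Set₁
  EvPreservesForall 𝓜 =
    ∀ (A B : Obj Sg) (f : Mor A B) (R : Fm Sg (ar A) → Fm Sg (ar B)) →
    RightAdjoint f R →
    ∀ S → Pf T (ar A) S (fm A) →
    ∀ M → 𝓜 M → ∀ (b : Fin (ar B) → Carrier (str M)) → ⟦ str M ⟧ (fm B) b →
    (⟦ str M ⟧ (R S) b → ForallEv 𝓜 f S M b) × (ForallEv 𝓜 f S M b → ⟦ str M ⟧ (R S) b)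

{-# OPTIONS --safe #-}
module Submission where

-- (a) If Ev f is invertible, then in every model of 𝓜 the converse relation of f is the graph of
-- the inverse.  By conservativity the sequents saying that the converse is a functional relation
-- inverse to f are provable, so f is an isomorphism of C_T.
--
-- (b) One inclusion is soundness of the counit f*(∀_f S) ≤ S, transported along homomorphisms.
-- Conversely, let b ∈ ∀_{Ev f}(Ev S) at M.  Every T_M-model coming from 𝓜 satisfies
-- A(x) ∧ θ(b, x) ⊢ S(x), so T_M proves it by strong conservativity.  Induction on T_M-derivations
-- turns the finitely many facts about M used into one regular formula δ(y) with M ⊨ δ(b) such
-- that every T-model satisfies δ(y) ∧ A(x) ∧ θ(y, x) ⊢ S(x): each occurrence of a constant is
-- replaced by its own variable, the variables other than y are quantified existentially, and
-- whenever two variables must name the same constant their equation is added to δ, so equality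
-- in M never has to be decided.  Then f*(δ ∧ B) ≤ S by conservativity, hence δ ∧ B ≤ ∀_f S, and
-- soundness at b gives b ∈ Ev(∀_f S)(M).

open import Defs
open import Data.Nat using (ℕ; zero; suc; _+_)
open import Data.Fin using (Fin; zero; suc; _↑ˡ_; _↑ʳ_; splitAt)
open import Data.Fin.Properties using (splitAt⁻¹-↑ˡ; splitAt⁻¹-↑ʳ)
open import Data.Vec using (Vec; []; _∷_)
open import Data.Vec.Functional.Properties using (lookup-++ˡ; lookup-++ʳ; ++-cong)
open import Data.Sum using (inj₁; inj₂)
open import Data.Product using (Σ-syntax; _×_; _,_; proj₁; proj₂; uncurry)
import Data.Product as Product
open import Data.Product.Function.NonDependent.Propositional using (_×-⇔_)
open import Data.Product.Function.Dependent.Propositional using (congˡ)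
open import Function.Related.Propositional using (equivalence)
open import Data.Unit using (tt)
open import Function using (_∘_; id)
open import Function.Bundles using (_⇔_; mk⇔; Equivalence)
import Function.Properties.Equivalence as ⇔
open import Relation.Binary.PropositionalEquality

open Equivalence using (to; from)

≡⇒⇔ : ∀ {A B : Set} → A ≡ B → A ⇔ B
≡⇒⇔ refl = ⇔.refl

converse : ∀ {Sg : Signature} {m n} → Fm Sg (m + n) → Fm Sg (n + m)
converse {m = m} {n} = renF ⟨ (n ↑ʳ_) , (_↑ˡ m) ⟩

functional-ant : ∀ {Sg : Signature} {m n} → Fm Sg (m + n) → Fm Sg (m + (m + n))
functional-ant {m = m} {n} θ =
  renF (m ↑ʳ_) θ ∧ᶠ renF ⟨ (_↑ˡ (m + n)) , (λ l → m ↑ʳ (m ↑ʳ l)) ⟩ θ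

functional-con : ∀ {Sg : Signature} m n → Fm Sg (m + (m + n))
functional-con m n = ⋀ (λ i → var (m ↑ʳ (i ↑ˡ n)) ≐ var (i ↑ˡ (m + n)))

module _ {X : Set} where

  ⟨⟩-∘ : ∀ {a b} {Y : Set} (e : Y → X) (f : Fin a → Y) (g : Fin b → Y) →
         e ∘ ⟨ f , g ⟩ ≗ ⟨ e ∘ f , e ∘ g ⟩
  ⟨⟩-∘ {a} e f g x with splitAt a x
  ... | inj₁ i = refl
  ... | inj₂ j = refl

  split-η : ∀ a {b} (e : Fin (a + b) → X) → e ≗ ⟨ e ∘ (_↑ˡ b) , e ∘ (a ↑ʳ_) ⟩
  split-η a e x with splitAt a x in eq
  ... | inj₁ i = cong e (sym (splitAt⁻¹-↑ˡ eq))
  ... | inj₂ j = cong e (sym (splitAt⁻¹-↑ʳ eq))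

  ∷ₑ-η : ∀ {n} (h : Fin (suc n) → X) → h ≗ _∷ₑ_ {n} (h zero) (h ∘ suc)
  ∷ₑ-η h zero    = refl
  ∷ₑ-η h (suc x) = refl

  ∷ₑ-⟨⟩ : ∀ {m n} (a : X) (w : Fin m → X) (e : Fin n → X) →
          _∷ₑ_ {m + n} a ⟨ w , e ⟩ ≗ ⟨_,_⟩ {suc m} (_∷ₑ_ {m} a w) e
  ∷ₑ-⟨⟩ a w e zero = refl
  ∷ₑ-⟨⟩ {m} a w e (suc x) with splitAt m x
  ... | inj₁ i = refl
  ... | inj₂ j = refl

  ⟨⟩-uncons : ∀ {m n} (w : Fin (suc m) → X) (e : Fin n → X) →
              ⟨_,_⟩ {suc m} w e ≗ _∷ₑ_ {m + n} (w zero) ⟨ w ∘ suc , e ⟩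
  ⟨⟩-uncons w e x =
    trans (++-cong w _ (∷ₑ-η w) (λ _ → refl) x) (sym (∷ₑ-⟨⟩ (w zero) (w ∘ suc) e x))

module _ {Sg : Signature} where

  mutual
    sub-id : ∀ {n} {σ : Fin n → Term Sg n} → σ ≗ var → ∀ t → sub σ t ≡ t
    sub-id σ≗var (var i)    = σ≗var i
    sub-id σ≗var (app f ts) = cong (app f) (subs-id σ≗var ts)

    subs-id : ∀ {n k} {σ : Fin n → Term Sg n} → σ ≗ var →
              (ts : Vec (Term Sg n) k) → subs σ ts ≡ ts
    subs-id σ≗var []       = refl
    subs-id σ≗var (t ∷ ts) = cong₂ _∷_ (sub-id σ≗var t) (subs-id σ≗var ts)

  lift-id : ∀ {n} {σ : Fin n → Term Sg n} → σ ≗ var → lift σ ≗ var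
  lift-id σ≗var zero    = refl
  lift-id σ≗var (suc i) = cong (ren suc) (σ≗var i)

  subF-id : ∀ {n} {σ : Fin n → Term Sg n} → σ ≗ var → ∀ φ → subF σ φ ≡ φ
  subF-id σ≗var ⊤ᶠ         = refl
  subF-id σ≗var (φ ∧ᶠ ψ)   = cong₂ _∧ᶠ_ (subF-id σ≗var φ) (subF-id σ≗var ψ)
  subF-id σ≗var (∃ᶠ φ)     = cong ∃ᶠ (subF-id (lift-id σ≗var) φ)
  subF-id σ≗var (s ≐ t)    = cong₂ _≐_ (sub-id σ≗var s) (sub-id σ≗var t)
  subF-id σ≗var (rel R ts) = cong (rel R) (subs-id σ≗var ts)

module _ {Sg : Signature} (N : Structure Sg) where

  mutual
    evalT-sub : ∀ {n m} (σ : Fin n → Term Sg m) {e : Fin m → Carrier N} {e' : Fin n → Carrier N} →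
                evalT N e ∘ σ ≗ e' → ∀ t → evalT N e (sub σ t) ≡ evalT N e' t
    evalT-sub σ σe≗e' (var i)    = σe≗e' i
    evalT-sub σ σe≗e' (app f ts) = cong (funI N f) (evalTs-sub σ σe≗e' ts)

    evalTs-sub : ∀ {n m k} (σ : Fin n → Term Sg m) {e : Fin m → Carrier N} {e' : Fin n → Carrier N} →
                 evalT N e ∘ σ ≗ e' →
                 (ts : Vec (Term Sg n) k) → evalTs N e (subs σ ts) ≡ evalTs N e' ts
    evalTs-sub σ σe≗e' []       = refl
    evalTs-sub σ σe≗e' (t ∷ ts) = cong₂ _∷_ (evalT-sub σ σe≗e' t) (evalTs-sub σ σe≗e' ts)

  evalT-lift : ∀ {n m} (σ : Fin n → Term Sg m) (a : Carrier N)
               {e : Fin m → Carrier N} {e' : Fin n → Carrier N} →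
               evalT N e ∘ σ ≗ e' → evalT N (_∷ₑ_ {m} a e) ∘ lift σ ≗ _∷ₑ_ {n} a e'
  evalT-lift σ a σe≗e' zero    = refl
  evalT-lift σ a σe≗e' (suc i) = trans (evalT-sub (var ∘ suc) (λ _ → refl) (σ i)) (σe≗e' i)

  ⟦⟧-subF : ∀ {n m} (φ : Fm Sg n) (σ : Fin n → Term Sg m)
            {e : Fin m → Carrier N} {e' : Fin n → Carrier N} →
            evalT N e ∘ σ ≗ e' → ⟦ N ⟧ (subF σ φ) e ⇔ ⟦ N ⟧ φ e'
  ⟦⟧-subF ⊤ᶠ         σ σe≗e' = ⇔.refl
  ⟦⟧-subF (φ ∧ᶠ ψ)   σ σe≗e' = ⟦⟧-subF φ σ σe≗e' ×-⇔ ⟦⟧-subF ψ σ σe≗e'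
  ⟦⟧-subF (∃ᶠ φ)     σ σe≗e' =
    congˡ {k = equivalence} λ {a} → ⟦⟧-subF φ (lift σ) (evalT-lift σ a σe≗e')
  ⟦⟧-subF (s ≐ t)    σ σe≗e' = ≡⇒⇔ (cong₂ _≡_ (evalT-sub σ σe≗e' s) (evalT-sub σ σe≗e' t))
  ⟦⟧-subF (rel R ts) σ σe≗e' = ≡⇒⇔ (cong (relI N R) (evalTs-sub σ σe≗e' ts))

  ⟦⟧-cong⇔ : ∀ {n} (φ : Fm Sg n) {e e' : Fin n → Carrier N} → e ≗ e' → ⟦ N ⟧ φ e ⇔ ⟦ N ⟧ φ e'
  ⟦⟧-cong⇔ φ {e} {e'} e≗e' =
    subst (λ ψ → ⟦ N ⟧ ψ e ⇔ ⟦ N ⟧ φ e') (subF-id (λ _ → refl) φ) (⟦⟧-subF φ var e≗e')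

  ⟦⟧-cong : ∀ {n} (φ : Fm Sg n) {e e' : Fin n → Carrier N} → e ≗ e' → ⟦ N ⟧ φ e → ⟦ N ⟧ φ e'
  ⟦⟧-cong φ e≗e' = to (⟦⟧-cong⇔ φ e≗e')

  ⟦⟧-renF : ∀ {n m} (φ : Fm Sg n) (ρ : Fin n → Fin m) (e : Fin m → Carrier N) →
            ⟦ N ⟧ (renF ρ φ) e ⇔ ⟦ N ⟧ φ (e ∘ ρ)
  ⟦⟧-renF φ ρ e = ⟦⟧-subF φ (var ∘ ρ) (λ _ → refl)

  ⟦⟧-∃* : ∀ m {n} (φ : Fm Sg (m + n)) (e : Fin n → Carrier N) →
          ⟦ N ⟧ (∃* m φ) e ⇔ (Σ[ w ∈ (Fin m → Carrier N) ] ⟦ N ⟧ φ ⟨ w , e ⟩)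
  ⟦⟧-∃* zero    φ e = mk⇔ (λ p → (λ ()) , p) proj₂
  ⟦⟧-∃* (suc m) φ e = ⇔.trans (⟦⟧-∃* m (∃ᶠ φ) e) (mk⇔
    (λ { (w , a , p) → _∷ₑ_ {m} a w , ⟦⟧-cong φ (∷ₑ-⟨⟩ a w e) p })
    (λ { (w , p) → w ∘ suc , w zero , ⟦⟧-cong φ (⟨⟩-uncons w e) p }))

  ⟦⟧-⋀ : ∀ {k n} (φs : Fin k → Fm Sg n) (e : Fin n → Carrier N) →
         ⟦ N ⟧ (⋀ φs) e ⇔ (∀ i → ⟦ N ⟧ (φs i) e)
  ⟦⟧-⋀ {zero}  φs e = mk⇔ (λ _ ()) (λ _ → tt)
  ⟦⟧-⋀ {suc k} φs e = mk⇔
    (λ { (p , q) zero → p ; (p , q) (suc i) → to (⟦⟧-⋀ (φs ∘ suc) e) q i })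
    (λ h → h zero , from (⟦⟧-⋀ (φs ∘ suc) e) (h ∘ suc))

  ⟦⟧-renF-≗ : ∀ {n m} (φ : Fm Sg n) {ρ : Fin n → Fin m}
              {e : Fin m → Carrier N} {e' : Fin n → Carrier N} →
              e ∘ ρ ≗ e' → ⟦ N ⟧ (renF ρ φ) e ⇔ ⟦ N ⟧ φ e'
  ⟦⟧-renF-≗ φ {ρ} eq = ⇔.trans (⟦⟧-renF φ ρ _) (⟦⟧-cong⇔ φ eq)

  ⟦⟧-compF : ∀ {T : Theory Sg} {n m k} (θ : Fm Sg (m + n)) (η : Fm Sg (k + m))
             (z : Fin k → Carrier N) (x : Fin n → Carrier N) →
             ⟦ N ⟧ (compF {T = T} {n} {m} {k} θ η) ⟨ z , x ⟩ ⇔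
             (Σ[ y ∈ (Fin m → Carrier N) ] ⟦ N ⟧ θ ⟨ y , x ⟩ × ⟦ N ⟧ η ⟨ z , y ⟩)
  ⟦⟧-compF {n = n} {m} {k} θ η z x =
    ⇔.trans (⟦⟧-∃* m _ ⟨ z , x ⟩) (congˡ {k = equivalence} λ {y} →
      ⟦⟧-renF-≗ θ (θ-args y) ×-⇔ ⟦⟧-renF-≗ η (η-args y))
    where
      θ-args : ∀ y → ⟨ y , ⟨ z , x ⟩ ⟩ ∘ ⟨ (_↑ˡ (k + n)) , (λ l → m ↑ʳ (k ↑ʳ l)) ⟩ ≗ ⟨ y , x ⟩
      θ-args y i = trans (⟨⟩-∘ {a = m} ⟨ y , ⟨ z , x ⟩ ⟩ _ _ i) (++-cong _ _
        (lookup-++ˡ y _) (λ l → trans (lookup-++ʳ y _ (k ↑ʳ l)) (lookup-++ʳ z x l)) i)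
      η-args : ∀ y → ⟨ y , ⟨ z , x ⟩ ⟩ ∘ ⟨ (λ j → m ↑ʳ (j ↑ˡ n)) , (_↑ˡ (k + n)) ⟩ ≗ ⟨ z , y ⟩
      η-args y i = trans (⟨⟩-∘ {a = k} ⟨ y , ⟨ z , x ⟩ ⟩ _ _ i) (++-cong _ _
        (λ j → trans (lookup-++ʳ y _ (j ↑ˡ n)) (lookup-++ˡ z x j)) (lookup-++ˡ y _) i)

  ⟦⟧-idF : ∀ {T : Theory Sg} {n} (φ : Fm Sg n) (x' x : Fin n → Carrier N) →
           ⟦ N ⟧ (idF {T = T} φ) ⟨ x' , x ⟩ ⇔ (⟦ N ⟧ φ x × x' ≗ x)
  ⟦⟧-idF φ x' x = ⟦⟧-renF-≗ φ (lookup-++ʳ x' x) ×-⇔ ⇔.trans (⟦⟧-⋀ _ _) (mk⇔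
    (λ h i → trans (sym (lookup-++ˡ x' x i)) (trans (h i) (lookup-++ʳ x' x i)))
    (λ h i → trans (lookup-++ˡ x' x i) (trans (h i) (sym (lookup-++ʳ x' x i)))))

  ⟦⟧-converse : ∀ {m n} (θ : Fm Sg (m + n)) (a : Fin n → Carrier N) (b : Fin m → Carrier N) →
                ⟦ N ⟧ (converse {m = m} θ) ⟨ a , b ⟩ ⇔ ⟦ N ⟧ θ ⟨ b , a ⟩
  ⟦⟧-converse {m} θ a b = ⟦⟧-renF-≗ θ λ x →
    trans (⟨⟩-∘ {a = m} ⟨ a , b ⟩ _ _ x) (++-cong _ _ (lookup-++ʳ a b) (lookup-++ˡ a b) x)

  ⟦⟧-functional-ant : ∀ {m n} (θ : Fm Sg (m + n)) (b' b : Fin m → Carrier N)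
                      (a : Fin n → Carrier N) →
                      ⟦ N ⟧ (functional-ant {m = m} θ) ⟨ b' , ⟨ b , a ⟩ ⟩ ⇔
                      (⟦ N ⟧ θ ⟨ b , a ⟩ × ⟦ N ⟧ θ ⟨ b' , a ⟩)
  ⟦⟧-functional-ant {m} θ b' b a = ⟦⟧-renF-≗ θ (lookup-++ʳ b' _) ×-⇔ ⟦⟧-renF-≗ θ λ x →
    trans (⟨⟩-∘ {a = m} ⟨ b' , ⟨ b , a ⟩ ⟩ _ _ x) (++-cong _ _
      (lookup-++ˡ b' _) (λ l → trans (lookup-++ʳ b' _ (m ↑ʳ l)) (lookup-++ʳ b a l)) x)

  ⟦⟧-functional-con : ∀ {m n} (b' b : Fin m → Carrier N) (a : Fin n → Carrier N) →
                      ⟦ N ⟧ (functional-con m n) ⟨ b' , ⟨ b , a ⟩ ⟩ ⇔ b ≗ b'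
  ⟦⟧-functional-con {m} b' b a = ⇔.trans (⟦⟧-⋀ _ _) (mk⇔
    (λ h i → trans (sym (b-at i)) (trans (h i) (lookup-++ˡ b' _ i)))
    (λ h i → trans (b-at i) (trans (h i) (sym (lookup-++ˡ b' _ i)))))
    where
      b-at : ∀ i → ⟨ b' , ⟨ b , a ⟩ ⟩ (m ↑ʳ (i ↑ˡ _)) ≡ b i
      b-at i = trans (lookup-++ʳ b' _ (i ↑ˡ _)) (lookup-++ˡ b a i)

module _ {Sg : Signature} {A : Set} (N : Structure Sg) (c : A → Carrier N) where

  mutual
    evalT-trT : ∀ {n} (e : Fin n → Carrier N) (t : Term Sg n) →
                evalT (expand N c) e (trT {A = A} t) ≡ evalT N e t
    evalT-trT e (var i)    = refl
    evalT-trT e (app f ts) = cong (funI N f) (evalTs-trTs e ts)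

    evalTs-trTs : ∀ {n k} (e : Fin n → Carrier N) (ts : Vec (Term Sg n) k) →
                  evalTs (expand N c) e (trTs {A = A} ts) ≡ evalTs N e ts
    evalTs-trTs e []       = refl
    evalTs-trTs e (t ∷ ts) = cong₂ _∷_ (evalT-trT e t) (evalTs-trTs e ts)

  ⟦⟧-trF : ∀ {n} (φ : Fm Sg n) (e : Fin n → Carrier N) →
           ⟦ expand N c ⟧ (trF {A = A} φ) e ⇔ ⟦ N ⟧ φ e
  ⟦⟧-trF ⊤ᶠ         e = ⇔.refl
  ⟦⟧-trF (φ ∧ᶠ ψ)   e = ⟦⟧-trF φ e ×-⇔ ⟦⟧-trF ψ e
  ⟦⟧-trF (∃ᶠ φ)     e = congˡ {k = equivalence} λ {a} → ⟦⟧-trF φ _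
  ⟦⟧-trF (s ≐ t)    e = ≡⇒⇔ (cong₂ _≡_ (evalT-trT e s) (evalT-trT e t))
  ⟦⟧-trF (rel R ts) e = ≡⇒⇔ (cong (relI N R) (evalTs-trTs e ts))

module _ {Sg : Signature} {T : Theory Sg} (N : Model T) where

  soundness : ∀ {n φ ψ} → Pf T n φ ψ → ∀ e → ⟦ str N ⟧ φ e → ⟦ str N ⟧ ψ e
  soundness (ax t)     e p = sound N _ t e p
  soundness idR        e p = p
  soundness (cut P Q)  e p = soundness Q e (soundness P e p)
  soundness (substR {φ = φ} {ψ} σ P) e p =
    from (⟦⟧-subF (str N) ψ σ (λ _ → refl))
      (soundness P _ (to (⟦⟧-subF (str N) φ σ (λ _ → refl)) p))
  soundness (eqRefl t) e p = refl
  soundness (eqSub φ s t) e (s≡t , p) =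
    from (⟦⟧-subF (str N) φ (single t) (λ _ → refl))
      (⟦⟧-cong (str N) φ single-agree (to (⟦⟧-subF (str N) φ (single s) (λ _ → refl)) p))
    where
      single-agree : evalT (str N) e ∘ single s ≗ evalT (str N) e ∘ single t
      single-agree zero    = s≡t
      single-agree (suc i) = refl
  soundness ⊤I         e p = tt
  soundness ∧E₁        e (p , q) = p
  soundness ∧E₂        e (p , q) = q
  soundness (∧I P Q)   e p = soundness P e p , soundness Q e p
  soundness (∃E {ψ = ψ} P) e (a , p) = to (⟦⟧-renF (str N) ψ suc _) (soundness P _ p)
  soundness (∃E⁻¹ {φ = φ} {ψ} P) e p =
    from (⟦⟧-renF (str N) ψ suc e)
      (soundness P (e ∘ suc) (e zero , ⟦⟧-cong (str N) φ (∷ₑ-η e) p))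
  soundness (frob {φ = φ}) e (p , a , q) = a , from (⟦⟧-renF (str N) φ suc _) p , q

module _ {Sg : Signature} {T : Theory Sg} where

  record IsFunction (N : Model T) (A B : Obj Sg) (θ : Fm Sg (ar B + ar A)) : Set where
    private
      Dom = Fin (ar A) → Carrier (str N)
      Cod = Fin (ar B) → Carrier (str N)
    field
      in-dom-cod    : ∀ (b : Cod) (a : Dom) → ⟦ str N ⟧ θ ⟨ b , a ⟩ →
                      ⟦ str N ⟧ (fm A) a × ⟦ str N ⟧ (fm B) b
      defined       : ∀ (a : Dom) → ⟦ str N ⟧ (fm A) a → Σ[ b ∈ Cod ] ⟦ str N ⟧ θ ⟨ b , a ⟩
      single-valued : ∀ (a : Dom) (b b' : Cod) →
                      ⟦ str N ⟧ θ ⟨ b , a ⟩ → ⟦ str N ⟧ θ ⟨ b' , a ⟩ → b ≗ b'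
  open IsFunction

  mor-isFunction : ∀ {A B} (f : Mor A B) (N : Model T) → IsFunction N A B (θ f)
  mor-isFunction {A} {B} f N .in-dom-cod b a p =
    let (pa , pb) = soundness N (typed f) _ p
    in to (⟦⟧-renF-≗ (str N) (fm A) (lookup-++ʳ b a)) pa ,
       to (⟦⟧-renF-≗ (str N) (fm B) (lookup-++ˡ b a)) pb
  mor-isFunction {A} {B} f N .defined a p =
    to (⟦⟧-∃* (str N) (ar B) (θ f) a) (soundness N (total f) a p)
  mor-isFunction {A} {B} f N .single-valued a b b' p p' =
    to (⟦⟧-functional-con (str N) b' b a)
       (soundness N (funct f) _ (from (⟦⟧-functional-ant (str N) (θ f) b' b a) (p , p')))

  module _ {𝓜 : Model T → Set} (conservative : Conservative 𝓜) where

    complete : ∀ {n} {φ ψ : Fm Sg n} →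
               (∀ N → 𝓜 N → ∀ e → ⟦ str N ⟧ φ e → ⟦ str N ⟧ ψ e) → Pf T n φ ψ
    complete {n} {φ} {ψ} = conservative (seq n φ ψ)

    complete-⟨⟩ : ∀ {a b} {φ ψ : Fm Sg (a + b)} →
                  (∀ N → 𝓜 N → ∀ (u : Fin a → Carrier (str N)) (v : Fin b → Carrier (str N)) →
                   ⟦ str N ⟧ φ ⟨ u , v ⟩ → ⟦ str N ⟧ ψ ⟨ u , v ⟩) →
                  Pf T (a + b) φ ψ
    complete-⟨⟩ {a} {φ = φ} {ψ} h = complete λ N 𝓜N e p →
      ⟦⟧-cong (str N) ψ (sym ∘ split-η a e) (h N 𝓜N _ _ (⟦⟧-cong (str N) φ (split-η a e) p))

    complete-⟨⟨⟩⟩ : ∀ {a b c} {φ ψ : Fm Sg (a + (b + c))} →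
                    (∀ N → 𝓜 N → ∀ (u : Fin a → Carrier (str N)) (v : Fin b → Carrier (str N))
                       (w : Fin c → Carrier (str N)) →
                       ⟦ str N ⟧ φ ⟨ u , ⟨ v , w ⟩ ⟩ → ⟦ str N ⟧ ψ ⟨ u , ⟨ v , w ⟩ ⟩) →
                    Pf T (a + (b + c)) φ ψ
    complete-⟨⟨⟩⟩ {a} {b} {φ = φ} {ψ} h = complete-⟨⟩ {a = a} λ N 𝓜N u v p →
      ⟦⟧-cong (str N) ψ (++-cong u u (λ _ → refl) (sym ∘ split-η b v))
        (h N 𝓜N u _ _ (⟦⟧-cong (str N) φ (++-cong u u (λ _ → refl) (split-η b v)) p))

    mkMor : ∀ {A B} (θ : Fm Sg (ar B + ar A)) → (∀ N → 𝓜 N → IsFunction N A B θ) → Mor A B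
    mkMor {A} {B} θ isF = record
      { θ     = θ
      ; typed = complete-⟨⟩ {a = m} λ N 𝓜N b a p →
          let (pa , pb) = isF N 𝓜N .in-dom-cod b a p
          in from (⟦⟧-renF-≗ (str N) (fm A) (lookup-++ʳ b a)) pa ,
             from (⟦⟧-renF-≗ (str N) (fm B) (lookup-++ˡ b a)) pb
      ; total = complete λ N 𝓜N a p → from (⟦⟧-∃* (str N) (ar B) θ a) (isF N 𝓜N .defined a p)
      ; funct = complete-⟨⟨⟩⟩ {a = m} {b = m} λ N 𝓜N b' b a p →
          from (⟦⟧-functional-con (str N) b' b a)
            (uncurry (isF N 𝓜N .single-valued a b b') (to (⟦⟧-functional-ant (str N) θ b' b a) p))
      }
      where
        m = ar B

    module _ {A B : Obj Sg} (f : Mor A B) (iso : EvIso 𝓜 f) where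
      open EvIso iso
      private
        m = ar B
        n = ar A

      ev-injective : ∀ N → 𝓜 N →
                     ∀ (y : Fin m → Carrier (str N)) (x x' : Fin n → Carrier (str N)) →
                     ⟦ str N ⟧ (θ f) ⟨ y , x ⟩ → ⟦ str N ⟧ (θ f) ⟨ y , x' ⟩ → x ≗ x'
      ev-injective N 𝓜N y x x' p p' i =
        let (px , py) = mor-isFunction f N .in-dom-cod y x p
            (px' , _) = mor-isFunction f N .in-dom-cod y x' p'
        in trans (sym (invLeft N 𝓜N x y px p py i)) (invLeft N 𝓜N x' y px' p' py i)

      converse-isFunction : ∀ N → 𝓜 N → IsFunction N B A (converse {m = m} (θ f))
      converse-isFunction N 𝓜N .in-dom-cod x y p =
        Product.swap (mor-isFunction f N .in-dom-cod y x (to (⟦⟧-converse (str N) (θ f) x y) p))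
      converse-isFunction N 𝓜N .defined y p =
        inv N 𝓜N y p , from (⟦⟧-converse (str N) (θ f) _ y) (invRight N 𝓜N y p)
      converse-isFunction N 𝓜N .single-valued y x x' p p' =
        ev-injective N 𝓜N y x x' (to (⟦⟧-converse (str N) (θ f) x y) p)
                                 (to (⟦⟧-converse (str N) (θ f) x' y) p')

      inverse : Mor B A
      inverse = mkMor (converse {m = m} (θ f)) converse-isFunction

      inverse-left : ProvEquiv (compF {T = T} {n} {m} {n} (θ f) (θ inverse)) (idF {T = T} (fm A))
      inverse-left = complete-⟨⟩ {a = n} (λ N 𝓜N x' x p →
          let (y , q , q') = to (⟦⟧-compF (str N) {T = T} (θ f) _ x' x) p
          in from (⟦⟧-idF (str N) {T = T} (fm A) x' x)
               (mor-isFunction f N .in-dom-cod y x q .proj₁ ,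
                ev-injective N 𝓜N y x' x (to (⟦⟧-converse (str N) (θ f) x' y) q') q))
        , complete-⟨⟩ {a = n} (λ N 𝓜N x' x p →
          let (px , x'≗x) = to (⟦⟧-idF (str N) {T = T} (fm A) x' x) p
              (y , q) = mor-isFunction f N .defined x px
          in from (⟦⟧-compF (str N) {T = T} (θ f) _ x' x)
               (y , q , from (⟦⟧-converse (str N) (θ f) x' y)
                             (⟦⟧-cong (str N) (θ f) (++-cong y y (λ _ → refl) (sym ∘ x'≗x)) q)))

      inverse-right : ProvEquiv (compF {T = T} {m} {n} {m} (θ inverse) (θ f)) (idF {T = T} (fm B))
      inverse-right = complete-⟨⟩ {a = m} (λ N 𝓜N y' y p →
          let (x , q , q') = to (⟦⟧-compF (str N) {T = T} (θ inverse) (θ f) y' y) p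
              q'' = to (⟦⟧-converse (str N) (θ f) x y) q
          in from (⟦⟧-idF (str N) {T = T} (fm B) y' y)
               (mor-isFunction f N .in-dom-cod y x q'' .proj₂ ,
                mor-isFunction f N .single-valued x y' y q' q'' ))
        , complete-⟨⟩ {a = m} (λ N 𝓜N y' y p →
          let (py , y'≗y) = to (⟦⟧-idF (str N) {T = T} (fm B) y' y) p
              q = invRight N 𝓜N y py
          in from (⟦⟧-compF (str N) {T = T} (θ inverse) (θ f) y' y)
               (inv N 𝓜N y py , from (⟦⟧-converse (str N) (θ f) _ y) q ,
                ⟦⟧-cong (str N) (θ f) (++-cong y y' (sym ∘ y'≗y) (λ _ → refl)) q))

    ev-conservative : EvConservative 𝓜
    ev-conservative A B f iso = inverse f iso , inverse-left f iso , inverse-right f iso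

module ConstantElimination {Sg : Signature} {T : Theory Sg} (M : Model T) where

  CM : Set
  CM = Carrier (str M)

  SgM : Signature
  SgM = SigC Sg CM

  cst : ∀ {n} → CM → Term SgM n
  cst a = app (inj₂ a) []

  -- AbsF p φ' φ : φ' arises from φ by replacing each occurrence of a constant a by a parameter
  -- variable n ↑ʳ j with p j ≡ a; different occurrences of a may use different parameters.
  module _ {k : ℕ} (p : Fin k → CM) where
    mutual
      data AbsT {n : ℕ} : Term Sg (n + k) → Term SgM n → Set where
        avar : (i : Fin n) → AbsT (var (i ↑ˡ k)) (var i)
        apar : (j : Fin k) {a : CM} → p j ≡ a → AbsT (var (n ↑ʳ j)) (cst a)
        aapp : (f : Fun Sg) {ts' : Vec (Term Sg (n + k)) (funAr Sg f)}
               {ts : Vec (Term SgM n) (funAr Sg f)} → AbsTs ts' ts → AbsT (app f ts') (app (inj₁ f) ts)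

      data AbsTs {n : ℕ} : ∀ {l} → Vec (Term Sg (n + k)) l → Vec (Term SgM n) l → Set where
        []  : AbsTs [] []
        _∷_ : ∀ {l t' t} {ts' : Vec (Term Sg (n + k)) l} {ts : Vec (Term SgM n) l} →
              AbsT t' t → AbsTs ts' ts → AbsTs (t' ∷ ts') (t ∷ ts)

    data AbsF : {n : ℕ} → Fm Sg (n + k) → Fm SgM n → Set where
      a⊤   : ∀ {n} → AbsF {n} ⊤ᶠ ⊤ᶠ
      a∧   : ∀ {n φ' φ ψ' ψ} → AbsF {n} φ' φ → AbsF {n} ψ' ψ → AbsF (φ' ∧ᶠ ψ') (φ ∧ᶠ ψ)
      a∃   : ∀ {n φ' φ} → AbsF {suc n} φ' φ → AbsF {n} (∃ᶠ φ') (∃ᶠ φ)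
      a≐   : ∀ {n s' s t' t} → AbsT {n} s' s → AbsT {n} t' t → AbsF (s' ≐ t') (s ≐ t)
      arel : ∀ {n} R {ts' ts} → AbsTs {n} ts' ts → AbsF (rel R ts') (rel R ts)

  AbsSub : ∀ {k k' n n'} (p : Fin k → CM) (p' : Fin k' → CM) →
           (Fin (n + k) → Term Sg (n' + k')) → (Fin n → Term SgM n') → Set
  AbsSub {k} {n = n} p p' τ σ =
    (∀ i → AbsT p' (τ (i ↑ˡ k)) (σ i)) × (∀ j → AbsT p' (τ (n ↑ʳ j)) (cst (p j)))

  module _ {k k' n n'} {p : Fin k → CM} {p' : Fin k' → CM}
           {τ : Fin (n + k) → Term Sg (n' + k')} {σ : Fin n → Term SgM n'}
           (τσ : AbsSub p p' τ σ) where
    mutual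
      AbsT-sub : ∀ {t' t} → AbsT p t' t → AbsT p' (sub τ t') (sub σ t)
      AbsT-sub (avar i)      = proj₁ τσ i
      AbsT-sub (apar j refl) = proj₂ τσ j
      AbsT-sub (aapp f ds)   = aapp f (AbsTs-sub ds)

      AbsTs-sub : ∀ {l} {ts' : Vec _ l} {ts} → AbsTs p ts' ts → AbsTs p' (subs τ ts') (subs σ ts)
      AbsTs-sub []       = []
      AbsTs-sub (d ∷ ds) = AbsT-sub d ∷ AbsTs-sub ds

  AbsT-renSuc : ∀ {k n} {p : Fin k → CM} {t' t} → AbsT p {n} t' t → AbsT p (ren suc t') (ren suc t)
  AbsT-renSuc = AbsT-sub ((λ i → avar (suc i)) , (λ j → apar j refl))

  AbsSub-lift : ∀ {k k' n n'} {p : Fin k → CM} {p' : Fin k' → CM}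
                {τ : Fin (n + k) → Term Sg (n' + k')} {σ : Fin n → Term SgM n'} →
                AbsSub p p' τ σ → AbsSub {n = suc n} {n' = suc n'} p p' (lift τ) (lift σ)
  AbsSub-lift τσ = lift-var , AbsT-renSuc ∘ proj₂ τσ
    where
      lift-var : ∀ i → _
      lift-var zero    = avar zero
      lift-var (suc i) = AbsT-renSuc (proj₁ τσ i)

  AbsF-sub : ∀ {k k' n n'} {p : Fin k → CM} {p' : Fin k' → CM}
             {τ : Fin (n + k) → Term Sg (n' + k')} {σ : Fin n → Term SgM n'} →
             AbsSub p p' τ σ → ∀ {φ' φ} → AbsF p φ' φ → AbsF p' (subF τ φ') (subF σ φ)
  AbsF-sub τσ a⊤          = a⊤
  AbsF-sub τσ (a∧ d d')   = a∧ (AbsF-sub τσ d) (AbsF-sub τσ d')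
  AbsF-sub τσ (a∃ d)      = a∃ (AbsF-sub (AbsSub-lift τσ) d)
  AbsF-sub τσ (a≐ d d')   = a≐ (AbsT-sub τσ d) (AbsT-sub τσ d')
  AbsF-sub τσ (arel R ds) = arel R (AbsTs-sub τσ ds)

  AbsF-renSuc : ∀ {k n} {p : Fin k → CM} {φ' φ} → AbsF p {n} φ' φ →
                AbsF p (renF suc φ') (renF suc φ)
  AbsF-renSuc = AbsF-sub ((λ i → avar (suc i)) , (λ j → apar j refl))

  wk : ∀ n {k k'} → (Fin k → Fin k') → Fin (n + k) → Fin (n + k')
  wk n {k' = k'} π = ⟨ (_↑ˡ k') , (n ↑ʳ_) ∘ π ⟩

  module _ {n k k' : ℕ} {p : Fin k → CM} {p' : Fin k' → CM}
           (π : Fin k → Fin k') (p'π≗p : p' ∘ π ≗ p) where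

    AbsSub-wk : AbsSub {n = n} p p' (var ∘ wk n π) var
    AbsSub-wk = (λ i → subst (λ x → AbsT p' (var x) (var i)) (sym (lookup-++ˡ (_↑ˡ k') _ i))
                             (avar i))
              , (λ j → subst (λ x → AbsT p' (var x) (cst (p j))) (sym (lookup-++ʳ {m = n} _ _ j))
                             (apar (π j) (p'π≗p j)))

    AbsT-weaken : ∀ {t' t} → AbsT p {n} t' t → AbsT p' (ren (wk n π) t') t
    AbsT-weaken {t' = t'} {t} d =
      subst (AbsT p' (ren (wk n π) t')) (sub-id (λ _ → refl) t) (AbsT-sub AbsSub-wk d)

    AbsTs-weaken : ∀ {l} {ts' : Vec _ l} {ts} → AbsTs p {n} ts' ts →
                   AbsTs p' (subs (var ∘ wk n π) ts') ts
    AbsTs-weaken {ts' = ts'} {ts} d =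
      subst (AbsTs p' (subs (var ∘ wk n π) ts')) (subs-id (λ _ → refl) ts) (AbsTs-sub AbsSub-wk d)

    AbsF-weaken : ∀ {φ' φ} → AbsF p {n} φ' φ → AbsF p' (renF (wk n π) φ') φ
    AbsF-weaken {φ' = φ'} {φ} d =
      subst (AbsF p' (renF (wk n π) φ')) (subF-id (λ _ → refl) φ) (AbsF-sub AbsSub-wk d)

  ⟦⟧-weaken : ∀ {n k k'} (N : Structure Sg) (π : Fin k → Fin k') (φ' : Fm Sg (n + k))
              {e : Fin n → Carrier N} {Z : Fin k' → Carrier N} {z : Fin k → Carrier N} →
              Z ∘ π ≗ z → ⟦ N ⟧ (renF (wk n π) φ') ⟨ e , Z ⟩ ⇔ ⟦ N ⟧ φ' ⟨ e , z ⟩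
  ⟦⟧-weaken {n} N π φ' {e} {Z} Zπ≗z = ⟦⟧-renF-≗ N φ' λ x →
    trans (⟨⟩-∘ {a = n} ⟨ e , Z ⟩ _ _ x)
          (++-cong _ _ (lookup-++ˡ e Z) (λ j → trans (lookup-++ʳ e Z (π j)) (Zπ≗z j)) x)

  mutual
    abstractT : ∀ {n} (t : Term SgM n) →
                Σ[ k ∈ ℕ ] Σ[ p ∈ (Fin k → CM) ] Σ[ t' ∈ Term Sg (n + k) ] AbsT p t' t
    abstractT (var i)             = 0 , (λ ()) , var (i ↑ˡ 0) , avar i
    abstractT (app (inj₁ f) ts)   =
      let (k , p , ts' , ds) = abstractTs ts in k , p , app f ts' , aapp f ds
    abstractT {n} (app (inj₂ a) []) = 1 , (λ _ → a) , var (n ↑ʳ zero) , apar zero refl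

    abstractTs : ∀ {n l} (ts : Vec (Term SgM n) l) →
                 Σ[ k ∈ ℕ ] Σ[ p ∈ (Fin k → CM) ] Σ[ ts' ∈ Vec (Term Sg (n + k)) l ]
                   AbsTs p ts' ts
    abstractTs []       = 0 , (λ ()) , [] , []
    abstractTs (t ∷ ts) =
      let (k₁ , p₁ , t' , d) = abstractT t
          (k₂ , p₂ , ts' , ds) = abstractTs ts
      in k₁ + k₂ , ⟨ p₁ , p₂ ⟩ , _ ,
         AbsT-weaken (_↑ˡ k₂) (lookup-++ˡ p₁ p₂) d ∷ AbsTs-weaken (k₁ ↑ʳ_) (lookup-++ʳ p₁ p₂) ds

  abstractF : ∀ {n} (φ : Fm SgM n) →
              Σ[ k ∈ ℕ ] Σ[ p ∈ (Fin k → CM) ] Σ[ φ' ∈ Fm Sg (n + k) ] AbsF p φ' φ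
  abstractF ⊤ᶠ       = 0 , (λ ()) , ⊤ᶠ , a⊤
  abstractF (φ ∧ᶠ ψ) =
    let (k₁ , p₁ , φ' , d) = abstractF φ
        (k₂ , p₂ , ψ' , d') = abstractF ψ
    in k₁ + k₂ , ⟨ p₁ , p₂ ⟩ , _ ,
       a∧ (AbsF-weaken (_↑ˡ k₂) (lookup-++ˡ p₁ p₂) d) (AbsF-weaken (k₁ ↑ʳ_) (lookup-++ʳ p₁ p₂) d')
  abstractF (∃ᶠ φ)   = let (k , p , φ' , d) = abstractF φ in k , p , ∃ᶠ φ' , a∃ d
  abstractF (s ≐ t)  =
    let (k₁ , p₁ , s' , d) = abstractT s
        (k₂ , p₂ , t' , d') = abstractT t
    in k₁ + k₂ , ⟨ p₁ , p₂ ⟩ , _ ,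
       a≐ (AbsT-weaken (_↑ˡ k₂) (lookup-++ˡ p₁ p₂) d) (AbsT-weaken (k₁ ↑ʳ_) (lookup-++ʳ p₁ p₂) d')
  abstractF (rel R ts) = let (k , p , ts' , ds) = abstractTs ts in k , p , rel R ts' , arel R ds

  abstractSub : ∀ {n m} (σ : Fin n → Term SgM m) →
                Σ[ k ∈ ℕ ] Σ[ p ∈ (Fin k → CM) ] Σ[ τ ∈ (Fin n → Term Sg (m + k)) ]
                  (∀ i → AbsT p (τ i) (σ i))
  abstractSub {zero}  σ = 0 , (λ ()) , (λ ()) , (λ ())
  abstractSub {suc n} {m} σ =
    let (k₁ , p₁ , t' , d) = abstractT (σ zero)
        (k₂ , p₂ , τ , ds) = abstractSub (σ ∘ suc)
    in k₁ + k₂ , ⟨ p₁ , p₂ ⟩ , _∷ₑ_ {n} (ren (wk m (_↑ˡ k₂)) t') (ren (wk m (k₁ ↑ʳ_)) ∘ τ) ,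
       λ { zero    → AbsT-weaken (_↑ˡ k₂) (lookup-++ˡ p₁ p₂) d
         ; (suc i) → AbsT-weaken (k₁ ↑ʳ_) (lookup-++ʳ p₁ p₂) (ds i) }

  record Certificate {k} (p : Fin k → CM) (Q : (N : Model T) → (Fin k → Carrier (str N)) → Set) :
                     Set₁ where
    constructor certificate
    field
      guard      : Fm Sg k
      guard-in-M : ⟦ str M ⟧ guard p
      sufficient : ∀ N z → ⟦ str N ⟧ guard z → Q N z

  module _ {k} {p : Fin k → CM} where

    cert-⊤ : ∀ {Q} → (∀ N z → Q N z) → Certificate p Q
    cert-⊤ h = certificate ⊤ᶠ tt (λ N z _ → h N z)

    cert-map : ∀ {Q Q'} → (∀ N z → Q N z → Q' N z) → Certificate p Q → Certificate p Q'
    cert-map h (certificate δ δM δQ) = certificate δ δM (λ N z d → h N z (δQ N z d))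

    cert-× : ∀ {Q Q'} → Certificate p Q → Certificate p Q' →
             Certificate p (λ N z → Q N z × Q' N z)
    cert-× (certificate δ δM δQ) (certificate δ' δM' δQ') =
      certificate (δ ∧ᶠ δ') (δM , δM') (λ N z (d , d') → δQ N z d , δQ' N z d')

    cert-weaken : ∀ {k'} {p' : Fin k' → CM} (π : Fin k → Fin k') → p' ∘ π ≗ p →
                  ∀ {Q} → Certificate p Q → Certificate p' (λ N z → Q N (z ∘ π))
    cert-weaken {p' = p'} π p'π≗p (certificate δ δM δQ) =
      certificate (renF π δ) (from (⟦⟧-renF-≗ (str M) δ p'π≗p) δM)
                  (λ N z d → δQ N (z ∘ π) (to (⟦⟧-renF (str N) δ π z) d))

  cert-∃ : ∀ {j k} (q : Fin j → CM) {p : Fin k → CM} {Q} → Certificate ⟨ q , p ⟩ Q →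
           Certificate p (λ N z → Σ[ w ∈ (Fin j → Carrier (str N)) ] Q N ⟨ w , z ⟩)
  cert-∃ {j} q {p} (certificate δ δM δQ) =
    certificate (∃* j δ) (from (⟦⟧-∃* (str M) j δ p) (q , δM))
                (λ N z d → let (w , d') = to (⟦⟧-∃* (str N) j δ z) d in w , δQ N _ d')

  mutual
    AbsT-agree : ∀ {k n} {p : Fin k → CM} {t₁ t₂ t} → AbsT p {n} t₁ t → AbsT p t₂ t →
                 Certificate p λ N z → ∀ e →
                   evalT (str N) ⟨ e , z ⟩ t₁ ≡ evalT (str N) ⟨ e , z ⟩ t₂
    AbsT-agree (avar i) (avar .i) = cert-⊤ (λ N z e → refl)
    AbsT-agree (apar j refl) (apar j' pj'≡a) =
      certificate (var j ≐ var j') (sym pj'≡a)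
        (λ N z zj≡zj' e → trans (lookup-++ʳ e z j) (trans zj≡zj' (sym (lookup-++ʳ e z j'))))
    AbsT-agree (aapp f ds) (aapp .f ds') =
      cert-map (λ N z h e → cong (funI (str N) f) (h e)) (AbsTs-agree ds ds')

    AbsTs-agree : ∀ {k n l} {p : Fin k → CM} {ts₁ ts₂ : Vec _ l} {ts} →
                  AbsTs p {n} ts₁ ts → AbsTs p ts₂ ts →
                  Certificate p λ N z → ∀ e →
                    evalTs (str N) ⟨ e , z ⟩ ts₁ ≡ evalTs (str N) ⟨ e , z ⟩ ts₂
    AbsTs-agree [] [] = cert-⊤ (λ N z e → refl)
    AbsTs-agree (d ∷ ds) (d' ∷ ds') =
      cert-map (λ N z (h , hs) e → cong₂ _∷_ (h e) (hs e))
        (cert-× (AbsT-agree d d') (AbsTs-agree ds ds'))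

  AbsF-agree : ∀ {k n} {p : Fin k → CM} {φ₁ φ₂ φ} → AbsF p {n} φ₁ φ → AbsF p φ₂ φ →
               Certificate p λ N z → ∀ e →
                 ⟦ str N ⟧ φ₁ ⟨ e , z ⟩ → ⟦ str N ⟧ φ₂ ⟨ e , z ⟩
  AbsF-agree a⊤ a⊤ = cert-⊤ (λ N z e _ → tt)
  AbsF-agree (a∧ d₁ d₂) (a∧ d₁' d₂') =
    cert-map (λ N z (h₁ , h₂) e → Product.map (h₁ e) (h₂ e))
      (cert-× (AbsF-agree d₁ d₁') (AbsF-agree d₂ d₂'))
  AbsF-agree {n = n} (a∃ {φ' = φ₁} d) (a∃ {φ' = φ₂} d') =
    cert-map (λ N z h e (a , x) → a , ⟦⟧-cong (str N) φ₂ (sym ∘ ∷ₑ-⟨⟩ a e z)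
                                       (h (_∷ₑ_ {n} a e) (⟦⟧-cong (str N) φ₁ (∷ₑ-⟨⟩ a e z) x)))
      (AbsF-agree d d')
  AbsF-agree (a≐ d₁ d₂) (a≐ d₁' d₂') =
    cert-map (λ N z (h₁ , h₂) e x → trans (sym (h₁ e)) (trans x (h₂ e)))
      (cert-× (AbsT-agree d₁ d₁') (AbsT-agree d₂ d₂'))
  AbsF-agree (arel R ds) (arel .R ds') =
    cert-map (λ N z h e → subst (relI (str N) R) (h e)) (AbsTs-agree ds ds')

  module _ {k} {p : Fin k → CM} (N : Structure Sg) where
    mutual
      evalT-AbsT-trT : ∀ {n} (t₀ : Term Sg n) {t'} → AbsT p t' (trT t₀) →
                       ∀ e z → evalT N ⟨ e , z ⟩ t' ≡ evalT N e t₀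
      evalT-AbsT-trT (var i)    (avar .i)    e z = lookup-++ˡ e z i
      evalT-AbsT-trT (app f ts) (aapp .f ds) e z = cong (funI N f) (evalTs-AbsTs-trTs ts ds e z)

      evalTs-AbsTs-trTs : ∀ {n l} (ts : Vec (Term Sg n) l) {ts'} → AbsTs p ts' (trTs ts) →
                          ∀ e z → evalTs N ⟨ e , z ⟩ ts' ≡ evalTs N e ts
      evalTs-AbsTs-trTs []       []       e z = refl
      evalTs-AbsTs-trTs (t ∷ ts) (d ∷ ds) e z =
        cong₂ _∷_ (evalT-AbsT-trT t d e z) (evalTs-AbsTs-trTs ts ds e z)

    ⟦⟧-AbsF-trF : ∀ {n} (φ₀ : Fm Sg n) {φ'} → AbsF p φ' (trF φ₀) →
                  ∀ e z → ⟦ N ⟧ φ' ⟨ e , z ⟩ ⇔ ⟦ N ⟧ φ₀ e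
    ⟦⟧-AbsF-trF ⊤ᶠ         a⊤          e z = ⇔.refl
    ⟦⟧-AbsF-trF (φ ∧ᶠ ψ)   (a∧ d d')   e z = ⟦⟧-AbsF-trF φ d e z ×-⇔ ⟦⟧-AbsF-trF ψ d' e z
    ⟦⟧-AbsF-trF {n} (∃ᶠ φ) (a∃ {φ' = φ'} d) e z = congˡ {k = equivalence} λ {a} →
      ⇔.trans (⟦⟧-cong⇔ N φ' (∷ₑ-⟨⟩ a e z)) (⟦⟧-AbsF-trF φ d (_∷ₑ_ {n} a e) z)
    ⟦⟧-AbsF-trF (s ≐ t)    (a≐ d d')   e z =
      ≡⇒⇔ (cong₂ _≡_ (evalT-AbsT-trT s d e z) (evalT-AbsT-trT t d' e z))
    ⟦⟧-AbsF-trF (rel R ts) (arel .R ds) e z = ≡⇒⇔ (cong (relI N R) (evalTs-AbsTs-trTs ts ds e z))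

  module _ {k} {p : Fin k → CM} where
    mutual
      evalT-AbsT-in-M : ∀ {n t' t} → AbsT p {n} t' t →
                        ∀ e → evalT (expand (str M) id) e t ≡ evalT (str M) ⟨ e , p ⟩ t'
      evalT-AbsT-in-M (avar i)      e = sym (lookup-++ˡ e p i)
      evalT-AbsT-in-M (apar j refl) e = sym (lookup-++ʳ e p j)
      evalT-AbsT-in-M (aapp f ds)   e = cong (funI (str M) f) (evalTs-AbsTs-in-M ds e)

      evalTs-AbsTs-in-M : ∀ {n l} {ts' : Vec _ l} {ts} → AbsTs p {n} ts' ts → ∀ e →
                          evalTs (expand (str M) id) e ts ≡ evalTs (str M) ⟨ e , p ⟩ ts'
      evalTs-AbsTs-in-M []       e = refl
      evalTs-AbsTs-in-M (d ∷ ds) e = cong₂ _∷_ (evalT-AbsT-in-M d e) (evalTs-AbsTs-in-M ds e)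

    AbsF-in-M : ∀ {n φ' φ} → AbsF p {n} φ' φ →
                ∀ e → ⟦ expand (str M) id ⟧ φ e → ⟦ str M ⟧ φ' ⟨ e , p ⟩
    AbsF-in-M a⊤          e _        = tt
    AbsF-in-M (a∧ d d')   e (x , y)  = AbsF-in-M d e x , AbsF-in-M d' e y
    AbsF-in-M {n} (a∃ {φ' = φ'} d) e (a , x) =
      a , ⟦⟧-cong (str M) φ' (sym ∘ ∷ₑ-⟨⟩ a e p) (AbsF-in-M d (_∷ₑ_ {n} a e) x)
    AbsF-in-M (a≐ d d')   e x = trans (sym (evalT-AbsT-in-M d e)) (trans x (evalT-AbsT-in-M d' e))
    AbsF-in-M (arel R ds) e x = subst (relI (str M) R) (evalTs-AbsTs-in-M ds e) x

    module _ {n n₀} (τ : Fin n₀ → Term Sg (n + k)) (σ : Fin n₀ → Term SgM n) where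
      mutual
        AbsT-trT : (∀ i → AbsT p (τ i) (σ i)) → ∀ t → AbsT p (sub τ t) (sub σ (trT t))
        AbsT-trT τσ (var i)    = τσ i
        AbsT-trT τσ (app f ts) = aapp f (AbsTs-trTs τσ ts)

        AbsTs-trTs : (∀ i → AbsT p (τ i) (σ i)) →
                     ∀ {l} (ts : Vec (Term Sg n₀) l) → AbsTs p (subs τ ts) (subs σ (trTs ts))
        AbsTs-trTs τσ []       = []
        AbsTs-trTs τσ (t ∷ ts) = AbsT-trT τσ t ∷ AbsTs-trTs τσ ts

    AbsF-trF : ∀ {n n₀} (τ : Fin n₀ → Term Sg (n + k)) (σ : Fin n₀ → Term SgM n) →
               (∀ i → AbsT p (τ i) (σ i)) → ∀ φ → AbsF p (subF τ φ) (subF σ (trF φ))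
    AbsF-trF τ σ τσ ⊤ᶠ         = a⊤
    AbsF-trF τ σ τσ (φ ∧ᶠ ψ)   = a∧ (AbsF-trF τ σ τσ φ) (AbsF-trF τ σ τσ ψ)
    AbsF-trF τ σ τσ (∃ᶠ φ)     = a∃ (AbsF-trF (lift τ) (lift σ) lift-τσ φ)
      where
        lift-τσ : ∀ i → AbsT p (lift τ i) (lift σ i)
        lift-τσ zero    = avar zero
        lift-τσ (suc i) = AbsT-renSuc (τσ i)
    AbsF-trF τ σ τσ (s ≐ t)    = a≐ (AbsT-trT τ σ τσ s) (AbsT-trT τ σ τσ t)
    AbsF-trF τ σ τσ (rel R ts) = arel R (AbsTs-trTs τ σ τσ ts)

  Entails : ∀ {n k} → Fm Sg (n + k) → Fm Sg (n + k) → (N : Model T) → (Fin k → Carrier (str N)) → Set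
  Entails {n} φ' ψ' N z =
    ∀ (e : Fin n → Carrier (str N)) → ⟦ str N ⟧ φ' ⟨ e , z ⟩ → ⟦ str N ⟧ ψ' ⟨ e , z ⟩

  Eliminable : ∀ {n} → Fm SgM n → Fm SgM n → Set₁
  Eliminable {n} φ ψ =
    ∀ {k} (p : Fin k → CM) {φ' ψ'} → AbsF p {n} φ' φ → AbsF p ψ' ψ → Certificate p (Entails φ' ψ')

  -- Two abstractions over the same parameters agree under a certificate, so a certificate for one
  -- abstraction of the sequent yields certificates for all of them.
  eliminable : ∀ {n} {φ ψ : Fm SgM n} {k} {p : Fin k → CM} {φ₀ ψ₀} →
               AbsF p φ₀ φ → AbsF p ψ₀ ψ → Certificate p (Entails φ₀ ψ₀) → Eliminable φ ψ
  eliminable {n} {k = k} {p} {φ₀} {ψ₀} dφ₀ dψ₀ c {k'} q {φ'} {ψ'} dφ' dψ' =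
    cert-map (λ N z (w , φ'⇒φ₀ , φ₀⇒ψ₀ , ψ₀⇒ψ') e →
                to (⟦⟧-weaken {n} (str N) (k ↑ʳ_) ψ' (lookup-++ʳ w z)) ∘ ψ₀⇒ψ' e
                ∘ from (⟦⟧-weaken {n} (str N) (_↑ˡ k') ψ₀ {e} {⟨ w , z ⟩} (λ _ → refl)) ∘ φ₀⇒ψ₀ e
                ∘ to (⟦⟧-weaken {n} (str N) (_↑ˡ k') φ₀ {e} {⟨ w , z ⟩} (λ _ → refl)) ∘ φ'⇒φ₀ e
                ∘ from (⟦⟧-weaken {n} (str N) (k ↑ʳ_) φ' (lookup-++ʳ w z)))
      (cert-∃ p (cert-× (AbsF-agree (weakenʳ dφ') (weakenˡ dφ₀))
                (cert-× (cert-weaken (_↑ˡ k') (lookup-++ˡ p q) c)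
                        (AbsF-agree (weakenˡ dψ₀) (weakenʳ dψ')))))
    where
      weakenˡ = AbsF-weaken (_↑ˡ k') (lookup-++ˡ p q)
      weakenʳ = AbsF-weaken (k ↑ʳ_) (lookup-++ʳ p q)

  elim-cut : ∀ {n} {φ χ ψ : Fm SgM n} → Eliminable φ χ → Eliminable χ ψ → Eliminable φ ψ
  elim-cut {φ = φ} {χ} {ψ} Eφχ Eχψ with abstractF (φ ∧ᶠ (χ ∧ᶠ ψ))
  ... | k , p , _ , a∧ dφ (a∧ dχ dψ) =
    eliminable dφ dψ
      (cert-map (λ N z (h₁ , h₂) e → h₂ e ∘ h₁ e) (cert-× (Eφχ p dφ dχ) (Eχψ p dχ dψ)))

  elim-subst : ∀ {n m} (σ : Fin n → Term SgM m) {φ ψ : Fm SgM n} →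
               Eliminable φ ψ → Eliminable (subF σ φ) (subF σ ψ)
  elim-subst {n} {m} σ {φ} {ψ} E with abstractF (φ ∧ᶠ ψ) | abstractSub σ
  ... | k₁ , q₁ , _ , a∧ {φ' = φ'} {ψ' = ψ'} dφ dψ | k₀ , q₀ , τ₀ , dτ₀ =
    eliminable (AbsF-sub τσ dφ) (AbsF-sub τσ dψ)
      (cert-map (λ N z h e → from (⟦⟧-τ N ψ' e z) ∘ h (evalT (str N) ⟨ e , z ⟩ ∘ τ₀')
                             ∘ to (⟦⟧-τ N φ' e z))
                (cert-weaken (k₀ ↑ʳ_) (lookup-++ʳ q₀ q₁) (E q₁ dφ dψ)))
    where
      τ₀' : Fin n → Term Sg (m + (k₀ + k₁))
      τ₀' = ren (wk m (_↑ˡ k₁)) ∘ τ₀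
      τ : Fin (n + k₁) → Term Sg (m + (k₀ + k₁))
      τ = ⟨ τ₀' , (λ l → var (m ↑ʳ (k₀ ↑ʳ l))) ⟩
      τσ : AbsSub q₁ ⟨ q₀ , q₁ ⟩ τ σ
      τσ = (λ i → subst (λ t → AbsT _ t (σ i)) (sym (lookup-++ˡ τ₀' _ i))
                        (AbsT-weaken (_↑ˡ k₁) (lookup-++ˡ q₀ q₁) (dτ₀ i)))
         , (λ l → subst (λ t → AbsT _ t (cst (q₁ l))) (sym (lookup-++ʳ τ₀' _ l))
                        (apar (k₀ ↑ʳ l) (lookup-++ʳ q₀ q₁ l)))
      ⟦⟧-τ : ∀ N (χ : Fm Sg (n + k₁)) e z →
             ⟦ str N ⟧ (subF τ χ) ⟨ e , z ⟩ ⇔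
             ⟦ str N ⟧ χ ⟨ evalT (str N) ⟨ e , z ⟩ ∘ τ₀' , z ∘ (k₀ ↑ʳ_) ⟩
      ⟦⟧-τ N χ e z = ⟦⟧-subF (str N) χ τ λ x →
        trans (⟨⟩-∘ {a = n} (evalT (str N) ⟨ e , z ⟩) _ _ x)
              (++-cong _ _ (λ _ → refl) (λ l → lookup-++ʳ e z (k₀ ↑ʳ l)) x)

  elim-eqSub : ∀ {n} (φ : Fm SgM (suc n)) (s t : Term SgM n) →
               Eliminable ((s ≐ t) ∧ᶠ subF (single s) φ) (subF (single t) φ)
  elim-eqSub {n} φ s t with abstractF ((s ≐ t) ∧ᶠ ∃ᶠ φ)
  ... | k , p , _ , a∧ (a≐ {s' = s'} {t' = t'} ds dt) (a∃ {φ' = φ'} dφ) =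
    eliminable (a∧ (a≐ ds dt) (AbsF-sub (τσ ds) dφ)) (AbsF-sub (τσ dt) dφ)
      (cert-⊤ λ N z e (s'≡t' , x) →
        from (⟦⟧-subF (str N) φ' (τ t') (sym ∘ τ-agree (str N) ⟨ e , z ⟩ s'≡t'))
             (to (⟦⟧-subF (str N) φ' (τ s') (λ _ → refl)) x))
    where
      τ : Term Sg (n + k) → Fin (suc n + k) → Term Sg (n + k)
      τ u' = ⟨_,_⟩ {suc n} (_∷ₑ_ {n} u' (λ i → var (i ↑ˡ k))) (λ j → var (n ↑ʳ j))
      τσ : ∀ {u u'} → AbsT p u' u → AbsSub p p (τ u') (single u)
      τσ {u} {u'} du =
          (λ i → subst (λ t → AbsT p t (single u i)) (sym (lookup-++ˡ {m = suc n} _ _ i)) (single-abs i))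
        , (λ j → subst (λ t → AbsT p t (cst (p j))) (sym (lookup-++ʳ {m = suc n} _ _ j)) (apar j refl))
        where
          single-abs : ∀ i → AbsT p (_∷ₑ_ {n} u' (λ i → var (i ↑ˡ k)) i) (single u i)
          single-abs zero    = du
          single-abs (suc i) = avar i
      τ-agree : ∀ N (E : Fin (n + k) → Carrier N) → evalT N E s' ≡ evalT N E t' →
                ∀ x → evalT N E (τ s' x) ≡ evalT N E (τ t' x)
      τ-agree N E s'≡t' x with splitAt (suc n) x
      ... | inj₁ zero    = s'≡t'
      ... | inj₁ (suc i) = refl
      ... | inj₂ j       = refl

  elim-∃E⁻¹ : ∀ {n} {φ : Fm SgM (suc n)} {ψ : Fm SgM n} →
              Eliminable (∃ᶠ φ) ψ → Eliminable φ (renF suc ψ)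
  elim-∃E⁻¹ {φ = φ} {ψ} E with abstractF (∃ᶠ φ ∧ᶠ ψ)
  ... | k , p , _ , a∧ {ψ' = ψ'} (a∃ {φ' = φ'} dφ) dψ =
    eliminable dφ (AbsF-renSuc dψ)
      (cert-map (λ N z h e → from (⟦⟧-renF-≗ (str N) ψ' (⟨⟩-uncons e z ∘ suc)) ∘ h (e ∘ suc)
                             ∘ (e zero ,_) ∘ ⟦⟧-cong (str N) φ' (⟨⟩-uncons e z))
                (E p (a∃ dφ) dψ))

  elim-frob : ∀ {n} {φ : Fm SgM n} {ψ} → Eliminable (φ ∧ᶠ ∃ᶠ ψ) (∃ᶠ (renF suc φ ∧ᶠ ψ))
  elim-frob {φ = φ} {ψ} with abstractF (φ ∧ᶠ ∃ᶠ ψ)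
  ... | k , p , _ , a∧ {φ' = φ'} dφ (a∃ dψ) =
    eliminable (a∧ dφ (a∃ dψ)) (a∃ (a∧ (AbsF-renSuc dφ) dψ))
      (cert-⊤ λ N z e (x , a , y) → a , from (⟦⟧-renF (str N) φ' suc _) x , y)

  eliminate : ∀ {n φ ψ} → Pf (ThM M) n φ ψ → Eliminable φ ψ
  eliminate (ax (base {s} t)) p dφ dψ = cert-⊤ λ N z e →
    from (⟦⟧-AbsF-trF (str N) (con s) dψ e z) ∘ sound N s t e
    ∘ to (⟦⟧-AbsF-trF (str N) (ant s) dφ e z)
  eliminate (ax (diag α _ α-in-M)) p {ψ' = ψ'} a⊤ dψ =
    certificate ψ' (AbsF-in-M dψ _ α-in-M) (λ N z g e _ → g)
  eliminate idR         p dφ dψ = cert-map (λ N z h → h) (AbsF-agree dφ dψ)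
  eliminate (cut P Q)           = elim-cut (eliminate P) (eliminate Q)
  eliminate (substR σ P)        = elim-subst σ (eliminate P)
  eliminate (eqRefl t)  p a⊤ (a≐ d d') = cert-map (λ N z h e _ → h e) (AbsT-agree d d')
  eliminate (eqSub φ s t)       = elim-eqSub φ s t
  eliminate ⊤I          p dφ a⊤ = cert-⊤ (λ N z e _ → tt)
  eliminate ∧E₁         p (a∧ d₁ d₂) dψ = cert-map (λ N z h e → h e ∘ proj₁) (AbsF-agree d₁ dψ)
  eliminate ∧E₂         p (a∧ d₁ d₂) dψ = cert-map (λ N z h e → h e ∘ proj₂) (AbsF-agree d₂ dψ)
  eliminate (∧I P Q)    p dφ (a∧ d₁ d₂) =
    cert-map (λ N z (h₁ , h₂) e x → h₁ e x , h₂ e x)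
      (cert-× (eliminate P p dφ d₁) (eliminate Q p dφ d₂))
  eliminate (∃E {n} P)  p {ψ' = ψ'} (a∃ {φ' = φ'} dφ) dψ =
    cert-map (λ N z h e (a , x) → to (⟦⟧-renF-≗ (str N) ψ' (sym ∘ ∷ₑ-⟨⟩ a e z ∘ suc))
                                    (h (_∷ₑ_ {n} a e) (⟦⟧-cong (str N) φ' (∷ₑ-⟨⟩ a e z) x)))
      (eliminate P p dφ (AbsF-renSuc dψ))
  eliminate (∃E⁻¹ P)            = elim-∃E⁻¹ (eliminate P)
  eliminate frob                = elim-frob

module _ {Sg : Signature} {T : Theory Sg} {𝓜 : Model T → Set} (sc : StronglyConservative 𝓜) where
  open IsFunction

  module _ {A B : Obj Sg} (f : Mor {T = T} A B) (S : Fm Sg (ar A)) (M : Model T) (𝓜M : 𝓜 M)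
           (b : Fin (ar B) → Carrier (str M)) where
    open ConstantElimination M
    private
      m = ar B
      n = ar A

    ForallEv⇒certificate :
      ForallEv 𝓜 f S M b →
      Certificate b (λ N y → ∀ a → ⟦ str N ⟧ (fm A) a → ⟦ str N ⟧ (θ f) ⟨ y , a ⟩ → ⟦ str N ⟧ S a)
    ForallEv⇒certificate ∀S =
      cert-map (λ N y h a pa θya → to (⟦⟧-renF-≗ (str N) S (lookup-++ˡ a y))
                                     (h a (from (⟦⟧-renF-≗ (str N) (fm A) (lookup-++ˡ a y)) pa ,
                                           from (⟦⟧-converse (str N) (θ f) a y) θya)))
        (eliminate proof-in-T_M b (a∧ (AbsF-trF-var (fm A)) (AbsF-trF _ σb σb-abs (θ f)))
                                  (AbsF-trF-var S))
      where
        σb : Fin (m + n) → Term SgM n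
        σb = ⟨ cst ∘ b , var ⟩

        σb-eval : ∀ {N : Structure Sg} (c : CM → Carrier N) (a : Fin n → Carrier N) →
                  evalT (expand N c) a ∘ σb ≗ ⟨ c ∘ b , a ⟩
        σb-eval c a x with splitAt m x
        ... | inj₁ i = refl
        ... | inj₂ j = refl

        σb-abs : ∀ x → AbsT b (var (⟨ (n ↑ʳ_) , (_↑ˡ m) ⟩ x)) (σb x)
        σb-abs x with splitAt m x
        ... | inj₁ i = apar i refl
        ... | inj₂ j = avar j

        AbsF-trF-var : ∀ φ → AbsF b (renF (_↑ˡ m) φ) (trF φ)
        AbsF-trF-var φ =
          subst (AbsF b (renF (_↑ˡ m) φ)) (subF-id (λ _ → refl) (trF φ)) (AbsF-trF _ var avar φ)

        proof-in-T_M : Pf (ThM M) n (trF (fm A) ∧ᶠ subF σb (trF (θ f))) (trF S)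
        proof-in-T_M = proj₂ sc M 𝓜M (seq n _ _) λ N 𝓜N h a (pa , θa) →
          from (⟦⟧-trF (str N) (hmap h) S a)
            (∀S N 𝓜N h a (to (⟦⟧-trF (str N) (hmap h) (fm A) a) pa)
               (to (⟦⟧-trF (str N) (hmap h) (θ f) _)
                   (to (⟦⟧-subF (expand (str N) (hmap h)) (trF (θ f)) σb (σb-eval (hmap h) a)) θa)))

  ev-preserves-∀ : EvPreservesForall 𝓜
  ev-preserves-∀ A B f R (R-subobject , R-adj) S S⊆A M 𝓜M b pb = forward , backward
    where
      counit : Pf T (ar A) (pull f (R S)) S
      counit = proj₂ (R-adj S (R S) S⊆A (R-subobject S S⊆A)) idR

      forward : ⟦ str M ⟧ (R S) b → ForallEv 𝓜 f S M b
      forward p N 𝓜N h a pa θa = soundness N counit a (from (⟦⟧-∃* (str N) (ar B) _ a)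
        (hmap h ∘ b , θa , from (⟦⟧-renF-≗ (str N) (R S) (lookup-++ˡ _ a)) (EvHom h (R S) b p)))

      backward : ForallEv 𝓜 f S M b → ⟦ str M ⟧ (R S) b
      backward ∀S = soundness M (proj₁ (R-adj S χ S⊆A ∧E₂) pull-χ⊢S) b (guard-in-M , pb)
        where
          open ConstantElimination.Certificate (ForallEv⇒certificate f S M 𝓜M b ∀S)
          χ = guard ∧ᶠ fm B
          pull-χ⊢S : Pf T (ar A) (pull f χ) S
          pull-χ⊢S = complete (proj₁ sc) λ N _ a p →
            let (y , θya , χy) = to (⟦⟧-∃* (str N) (ar B) _ a) p
                (gy , _) = to (⟦⟧-renF-≗ (str N) χ (lookup-++ˡ y a)) χy
            in sufficient N y gy a (mor-isFunction f N .in-dom-cod y a θya .proj₁) θya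

theorem3p2 : (Sg : Signature) (T : Theory Sg) (𝓜 : Model T → Set) →
             StronglyConservative 𝓜 →
             EvConservative 𝓜 × EvPreservesForall 𝓜
theorem3p2 Sg T 𝓜 sc = ev-conservative (proj₁ sc) , ev-preserves-∀ sc
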